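{- For every positive integer $n$, if the home state of $QR_n$ is taken to be the fully horizontal state (all links facing east), then the poset of states of $QR_n$ is a distributive lattice.
   Context: The robotic arm $QR_n$: $n$ unit links with base at $(0,0)$, each facing north or east; states are lattice paths of length $n$ with N/E steps. Moves: interchange two consecutive links that are N,E or E,N; switch the last link between E and N. The transition graph has the states as vertices and an edge between two states differing by one move. Given a home state $u$, the poset of states is defined by $p\le q$ iff there is a shortest edge-path in the transition graph from $u$ to $q$ that passes through $p$. -}

module Defs where

open import Data.Nat using (ℕ; zero; suc; _≤_)
open import Data.Vec using (Vec; []; _∷_; replicate)
open import Data.Product using (Σ; _×_; _,_)
open import Relation.Binary.PropositionalEquality using (_≡_; _≢_)

data Link : Set where
  N E : Link

-- A state of QR_n: the sequence of the n link directions (a lattice path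
-- of length n with N/E steps starting at the base (0,0)).
State : ℕ → Set
State n = Vec Link n

-- One move of the arm (an edge of the transition graph):
--  * swap: interchange two consecutive links that are N,E or E,N
--  * switch: switch the last link between E and N
--  * there: the move happens further along the arm
data Move : {n : ℕ} → State n → State n → Set where
  swap   : ∀ {n} {a b : Link} {xs : State n} → a ≢ b →
           Move (a ∷ b ∷ xs) (b ∷ a ∷ xs)
  switch : ∀ {a b : Link} → a ≢ b → Move (a ∷ []) (b ∷ [])
  there  : ∀ {n} {a : Link} {xs ys : State n} → Move xs ys →
           Move (a ∷ xs) (a ∷ ys)

data Walk {n : ℕ} : State n → State n → Set where
  []  : ∀ {x} → Walk x x
  _∷_ : ∀ {x y z} → Move x y → Walk y z → Walk x z

len : ∀ {n} {x y : State n} → Walk x y → ℕ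
len []      = 0
len (_ ∷ w) = suc (len w)

data PassesThrough {n : ℕ} (p : State n) : {x y : State n} → Walk x y → Set where
  here  : ∀ {y} {w : Walk p y} → PassesThrough p w
  later : ∀ {x y z} {m : Move x y} {w : Walk y z} →
          PassesThrough p w → PassesThrough p (m ∷ w)

Shortest : ∀ {n} {x y : State n} → Walk x y → Set
Shortest {x = x} {y = y} w = ∀ (w' : Walk x y) → len w ≤ len w'

_≼[_]_ : ∀ {n} → State n → State n → State n → Set
p ≼[ u ] q = Σ (Walk u q) (λ w → Shortest w × PassesThrough p w)

horizontal : (n : ℕ) → State n
horizontal n = replicate n E

-- A state p is determined by its prefix counts c_p(j), the number of north links among
-- its first j links; these are exactly the functions with c(0) = 0 and increments 0 or 1.
-- Every move changes the rank Σⱼ c_p(j) by exactly one, and a rank-raising move raises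
-- c_p pointwise. Conversely, if c_p ≤ c_q pointwise then q is reached from p by
-- rank-raising moves only. Hence the rank is the distance from the horizontal state, and
-- p ≤ q holds exactly when c_p ≤ c_q pointwise. Pointwise max and min of prefix-count
-- functions are again prefix-count functions, so the poset is a sublattice of the
-- distributive lattice of functions ℕ → ℕ.
module Submission where

open import Defs
open import Data.Nat using (ℕ; zero; suc; _+_; _∸_; _⊔_; _⊓_; _≤_; z≤n; s≤s; s≤s⁻¹)
open import Data.Nat.Properties
open import Data.Vec using ([]; _∷_)
open import Data.Product using (Σ; _,_; proj₁)
open import Data.Empty using (⊥-elim)
open import Algebra.Core using (Op₂)
open import Relation.Binary.Core using (Rel)
open import Relation.Binary.PropositionalEquality
  using (_≡_; refl; sym; trans; cong; cong₂; subst; isEquivalence; module ≡-Reasoning)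
open import Relation.Binary.Lattice.Structures using (IsDistributiveLattice)

module PointwiseSublattice
  {a i ℓ} {A : Set a} {I : Set i} {_≤ᴬ_ : Rel A ℓ} (h : A → I → ℕ)
  (h-injective : ∀ {p q} → (∀ i → h p i ≡ h q i) → p ≡ q)
  (≤ᴬ⇒≤ : ∀ {p q} → p ≤ᴬ q → ∀ i → h p i ≤ h q i)
  (≤⇒≤ᴬ : ∀ {p q} → (∀ i → h p i ≤ h q i) → p ≤ᴬ q)
  (_∨_ _∧_ : Op₂ A)
  (h-∨ : ∀ p q i → h (p ∨ q) i ≡ h p i ⊔ h q i)
  (h-∧ : ∀ p q i → h (p ∧ q) i ≡ h p i ⊓ h q i)
  where

  isDistributiveLattice : IsDistributiveLattice _≡_ _≤ᴬ_ _∨_ _∧_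
  isDistributiveLattice = record
    { isLattice = record
      { isPartialOrder = record
        { isPreorder = record
          { isEquivalence = isEquivalence
          ; reflexive = λ { refl → ≤⇒≤ᴬ (λ _ → ≤-refl) }
          ; trans = λ p≤q q≤r → ≤⇒≤ᴬ (λ i → ≤-trans (≤ᴬ⇒≤ p≤q i) (≤ᴬ⇒≤ q≤r i))
          }
        ; antisym = λ p≤q q≤p → h-injective (λ i → ≤-antisym (≤ᴬ⇒≤ p≤q i) (≤ᴬ⇒≤ q≤p i))
        }
      ; supremum = λ p q →
            ≤⇒≤ᴬ (λ i → subst (h p i ≤_) (sym (h-∨ p q i)) (m≤m⊔n _ _))
          , ≤⇒≤ᴬ (λ i → subst (h q i ≤_) (sym (h-∨ p q i)) (m≤n⊔m _ _))
          , λ r p≤r q≤r → ≤⇒≤ᴬ (λ i →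
              subst (_≤ h r i) (sym (h-∨ p q i)) (⊔-lub (≤ᴬ⇒≤ p≤r i) (≤ᴬ⇒≤ q≤r i)))
      ; infimum = λ p q →
            ≤⇒≤ᴬ (λ i → subst (_≤ h p i) (sym (h-∧ p q i)) (m⊓n≤m _ _))
          , ≤⇒≤ᴬ (λ i → subst (_≤ h q i) (sym (h-∧ p q i)) (m⊓n≤n _ _))
          , λ r r≤p r≤q → ≤⇒≤ᴬ (λ i →
              subst (h r i ≤_) (sym (h-∧ p q i)) (⊓-glb (≤ᴬ⇒≤ r≤p i) (≤ᴬ⇒≤ r≤q i)))
      }
    ; ∧-distribˡ-∨ = λ p q r → h-injective λ i → begin
        h (p ∧ (q ∨ r)) i                  ≡⟨ trans (h-∧ p (q ∨ r) i) (cong (h p i ⊓_) (h-∨ q r i)) ⟩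
        h p i ⊓ (h q i ⊔ h r i)            ≡⟨ ⊓-distribˡ-⊔ (h p i) (h q i) (h r i) ⟩
        (h p i ⊓ h q i) ⊔ (h p i ⊓ h r i)  ≡⟨ sym (trans (h-∨ (p ∧ q) (p ∧ r) i) (cong₂ _⊔_ (h-∧ p q i) (h-∧ p r i))) ⟩
        h ((p ∧ q) ∨ (p ∧ r)) i            ∎
    }
    where open ≡-Reasoning

northCount : ∀ {n} → State n → ℕ → ℕ
northCount p       zero    = 0
northCount []      (suc j) = 0
northCount (N ∷ p) (suc j) = suc (northCount p j)
northCount (E ∷ p) (suc j) = northCount p j

_⊑_ : ∀ {n} → Rel (State n) _
p ⊑ q = ∀ j → northCount p j ≤ northCount q j

⊑-refl : ∀ {n} {p : State n} → p ⊑ p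
⊑-refl j = ≤-refl

⊑-trans : ∀ {n} {p q r : State n} → p ⊑ q → q ⊑ r → p ⊑ r
⊑-trans p⊑q q⊑r j = ≤-trans (p⊑q j) (q⊑r j)

northCount-injective : ∀ {n} {p q : State n} → (∀ j → northCount p j ≡ northCount q j) → p ≡ q
northCount-injective {p = []}    {[]}    _  = refl
northCount-injective {p = N ∷ p} {N ∷ q} eq = cong (N ∷_) (northCount-injective (λ j → suc-injective (eq (suc j))))
northCount-injective {p = E ∷ p} {E ∷ q} eq = cong (E ∷_) (northCount-injective (λ j → eq (suc j)))
northCount-injective {p = N ∷ p} {E ∷ q} eq with eq 1
... | ()
northCount-injective {p = E ∷ p} {N ∷ q} eq with eq 1
... | ()

∷-⊑ : ∀ {n} a {p q : State n} → p ⊑ q → (a ∷ p) ⊑ (a ∷ q)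
∷-⊑ a p⊑q zero    = z≤n
∷-⊑ N p⊑q (suc j) = s≤s (p⊑q j)
∷-⊑ E p⊑q (suc j) = p⊑q j

northCount-horizontal : ∀ n j → northCount (horizontal n) j ≡ 0
northCount-horizontal n       zero    = refl
northCount-horizontal zero    (suc j) = refl
northCount-horizontal (suc n) (suc j) = northCount-horizontal n j

horizontal-⊑ : ∀ {n} (q : State n) → horizontal n ⊑ q
horizontal-⊑ {n} q j = subst (_≤ northCount q j) (sym (northCount-horizontal n j)) z≤n

-- A north link followed by k further links needs k swaps and a switch to become east,
-- so the rank will turn out to be the distance from the horizontal state.
rank : ∀ {n} → State n → ℕ
rank []              = 0
rank {suc n} (N ∷ p) = suc n + rank p
rank (E ∷ p)         = rank p

rank-horizontal : ∀ n → rank (horizontal n) ≡ 0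
rank-horizontal zero    = refl
rank-horizontal (suc n) = rank-horizontal n

rank-∷-suc : ∀ {n} a {p q : State n} → rank q ≡ suc (rank p) → rank (a ∷ q) ≡ suc (rank (a ∷ p))
rank-∷-suc {n} N {p} {q} eq = trans (cong (suc n +_) eq) (+-suc (suc n) (rank p))
rank-∷-suc     E         eq = eq

data Direction {n} (p q : State n) : Set where
  up   : rank q ≡ suc (rank p) → p ⊑ q → Direction p q
  down : rank p ≡ suc (rank q) → Direction p q

move-direction : ∀ {n} {p q : State n} → Move p q → Direction p q
move-direction (swap {a = N} {E} _) = down refl
move-direction (swap {a = E} {N} {xs} _) = up refl E,N⊑N,E
  where
  E,N⊑N,E : (E ∷ N ∷ xs) ⊑ (N ∷ E ∷ xs)
  E,N⊑N,E zero          = z≤n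
  E,N⊑N,E (suc zero)    = z≤n
  E,N⊑N,E (suc (suc j)) = ≤-refl
move-direction (swap {a = N} {N} N≢N) = ⊥-elim (N≢N refl)
move-direction (swap {a = E} {E} E≢E) = ⊥-elim (E≢E refl)
move-direction (switch {N} {E} _) = down refl
move-direction (switch {E} {N} _) = up refl E⊑N
  where
  E⊑N : (E ∷ []) ⊑ (N ∷ [])
  E⊑N zero          = z≤n
  E⊑N (suc zero)    = z≤n
  E⊑N (suc (suc j)) = z≤n
move-direction (switch {N} {N} N≢N) = ⊥-elim (N≢N refl)
move-direction (switch {E} {E} E≢E) = ⊥-elim (E≢E refl)
move-direction (there {a = a} m) with move-direction m
... | up   eq p⊑q = up (rank-∷-suc a eq) (∷-⊑ a p⊑q)
... | down eq      = down (rank-∷-suc a eq)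

_++ʷ_ : ∀ {n} {x y z : State n} → Walk x y → Walk y z → Walk x z
[]      ++ʷ w′ = w′
(m ∷ w) ++ʷ w′ = m ∷ (w ++ʷ w′)

len-++ʷ : ∀ {n} {x y z : State n} (w : Walk x y) (w′ : Walk y z) → len (w ++ʷ w′) ≡ len w + len w′
len-++ʷ []      w′ = refl
len-++ʷ (m ∷ w) w′ = cong suc (len-++ʷ w w′)

there* : ∀ {n} {a : Link} {x y : State n} → Walk x y → Walk (a ∷ x) (a ∷ y)
there* []      = []
there* (m ∷ w) = there m ∷ there* w

len-there* : ∀ {n} {a : Link} {x y : State n} (w : Walk x y) → len (there* {a = a} w) ≡ len w
len-there* []      = refl
len-there* (m ∷ w) = cong suc (len-there* w)

passesThrough-++ʷ : ∀ {n} {x y z : State n} (w : Walk x y) (w′ : Walk y z) → PassesThrough y (w ++ʷ w′)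
passesThrough-++ʷ []      w′ = here
passesThrough-++ʷ (m ∷ w) w′ = later (passesThrough-++ʷ w w′)

split-at : ∀ {n} {p x y : State n} {w : Walk x y} → PassesThrough p w →
           Σ (Walk x p) (λ w₁ → Σ (Walk p y) (λ w₂ → len w₁ + len w₂ ≡ len w))
split-at {w = w} here = [] , w , refl
split-at (later {m = m} through) with split-at through
... | w₁ , w₂ , eq = m ∷ w₁ , w₂ , cong suc eq

rank-≤-+-len : ∀ {n} {p q : State n} (w : Walk p q) → rank q ≤ rank p + len w
rank-≤-+-len {p = p} [] = ≤-reflexive (sym (+-identityʳ (rank p)))
rank-≤-+-len {p = p} {q} (_∷_ {y = r} m w) with move-direction m
... | up eq _ = begin
  rank q               ≤⟨ rank-≤-+-len w ⟩
  rank r + len w       ≡⟨ cong (_+ len w) eq ⟩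
  suc (rank p + len w) ≡⟨ +-suc (rank p) (len w) ⟨
  rank p + len (m ∷ w) ∎
  where open ≤-Reasoning
... | down eq = begin
  rank q               ≤⟨ rank-≤-+-len w ⟩
  rank r + len w       ≤⟨ n≤1+n _ ⟩
  suc (rank r) + len w ≡⟨ cong (_+ len w) eq ⟨
  rank p + len w       ≤⟨ +-monoʳ-≤ (rank p) (n≤1+n (len w)) ⟩
  rank p + len (m ∷ w) ∎
  where open ≤-Reasoning

-- A walk whose whole length is spent on rank gain contains no down-move.
rank-+-len-≤⇒⊑ : ∀ {n} {p q : State n} (w : Walk p q) → rank p + len w ≤ rank q → p ⊑ q
rank-+-len-≤⇒⊑ [] _ = ⊑-refl
rank-+-len-≤⇒⊑ {p = p} {q} (_∷_ {y = r} m w) tight with move-direction m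
... | up eq p⊑r = ⊑-trans p⊑r (rank-+-len-≤⇒⊑ w (begin
  rank r + len w       ≡⟨ cong (_+ len w) eq ⟩
  suc (rank p + len w) ≡⟨ +-suc (rank p) (len w) ⟨
  rank p + len (m ∷ w) ≤⟨ tight ⟩
  rank q               ∎))
  where open ≤-Reasoning
... | down eq = ⊥-elim (<-irrefl refl (begin-strict
  rank r + len w       <⟨ n<1+n _ ⟩
  suc (rank r) + len w ≡⟨ cong (_+ len w) eq ⟨
  rank p + len w       <⟨ +-monoʳ-< (rank p) (n<1+n (len w)) ⟩
  rank p + len (m ∷ w) ≤⟨ tight ⟩
  rank q               ≤⟨ rank-≤-+-len w ⟩
  rank r + len w       ∎))
  where open ≤-Reasoning

TightWalk : ∀ {n} → State n → State n → Set
TightWalk p q = Σ (Walk p q) (λ w → rank p + len w ≡ rank q)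

up-move : ∀ {n} {p q : State n} → Move p q → rank q ≡ suc (rank p) → TightWalk p q
up-move {p = p} m eq = m ∷ [] , trans (+-comm (rank p) 1) (sym eq)

tight-++ʷ : ∀ {n} {p q r : State n} → TightWalk p q → TightWalk q r → TightWalk p r
tight-++ʷ {p = p} {q} {r} (w , eq) (w′ , eq′) = w ++ʷ w′ , (begin
  rank p + len (w ++ʷ w′)    ≡⟨ cong (rank p +_) (len-++ʷ w w′) ⟩
  rank p + (len w + len w′)  ≡⟨ +-assoc (rank p) (len w) (len w′) ⟨
  rank p + len w + len w′    ≡⟨ cong (_+ len w′) eq ⟩
  rank q + len w′            ≡⟨ eq′ ⟩
  rank r                     ∎)
  where open ≡-Reasoning

tight-there* : ∀ {n} a {p q : State n} → TightWalk p q → TightWalk (a ∷ p) (a ∷ q)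
tight-there* {n} N {p} {q} (w , eq) = there* w , (begin
  suc n + rank p + len (there* w)  ≡⟨ cong (suc n + rank p +_) (len-there* w) ⟩
  suc n + rank p + len w           ≡⟨ +-assoc (suc n) (rank p) (len w) ⟩
  suc n + (rank p + len w)         ≡⟨ cong (suc n +_) eq ⟩
  suc n + rank q                   ∎)
  where open ≡-Reasoning
tight-there* E (w , eq) = there* w , trans (cong (_ +_) (len-there* w)) eq

eraseFirstNorth : ∀ {n} → State n → State n
eraseFirstNorth []      = []
eraseFirstNorth (N ∷ p) = E ∷ p
eraseFirstNorth (E ∷ p) = E ∷ eraseFirstNorth p

northCount-eraseFirstNorth : ∀ {n} (p : State n) j → northCount (eraseFirstNorth p) j ≡ northCount p j ∸ 1
northCount-eraseFirstNorth p       zero    = refl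
northCount-eraseFirstNorth []      (suc j) = refl
northCount-eraseFirstNorth (N ∷ p) (suc j) = refl
northCount-eraseFirstNorth (E ∷ p) (suc j) = northCount-eraseFirstNorth p j

pullFirstNorthToFront : ∀ {n} (p : State n) → TightWalk (E ∷ p) (N ∷ eraseFirstNorth p)
pullFirstNorthToFront []      = up-move (switch (λ ())) refl
pullFirstNorthToFront (N ∷ p) = up-move (swap (λ ())) refl
pullFirstNorthToFront (E ∷ p) =
  tight-++ʷ (tight-there* E (pullFirstNorthToFront p)) (up-move (swap (λ ())) refl)

⊑⇒tightWalk : ∀ {n} {p q : State n} → p ⊑ q → TightWalk p q
⊑⇒tightWalk {p = []}    {[]}    _   = [] , +-identityʳ 0
⊑⇒tightWalk {p = N ∷ p} {N ∷ q} p⊑q = tight-there* N (⊑⇒tightWalk (λ j → s≤s⁻¹ (p⊑q (suc j))))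
⊑⇒tightWalk {p = E ∷ p} {E ∷ q} p⊑q = tight-there* E (⊑⇒tightWalk (λ j → p⊑q (suc j)))
⊑⇒tightWalk {p = N ∷ p} {E ∷ q} p⊑q with p⊑q 1
... | ()
⊑⇒tightWalk {p = E ∷ p} {N ∷ q} p⊑q =
  tight-++ʷ (pullFirstNorthToFront p) (tight-there* N (⊑⇒tightWalk erased⊑q))
  where
  erased⊑q : eraseFirstNorth p ⊑ q
  erased⊑q j = subst (_≤ northCount q j) (sym (northCount-eraseFirstNorth p j))
                     (∸-monoˡ-≤ 1 (p⊑q (suc j)))

len-tightWalk-from-horizontal : ∀ {n} {q : State n} (t : TightWalk (horizontal n) q) → len (proj₁ t) ≡ rank q
len-tightWalk-from-horizontal {n} (w , eq) = trans (cong (_+ len w) (sym (rank-horizontal n))) eq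

rank-≤-len-from-horizontal : ∀ {n} {q : State n} (w : Walk (horizontal n) q) → rank q ≤ len w
rank-≤-len-from-horizontal {n} w = subst (_ ≤_) (cong (_+ len w) (rank-horizontal n)) (rank-≤-+-len w)

≼⇒⊑ : ∀ {n} {p q : State n} → p ≼[ horizontal n ] q → p ⊑ q
≼⇒⊑ {n} {p} {q} (w , shortest , through) with split-at through
... | w₁ , w₂ , eq = rank-+-len-≤⇒⊑ w₂ (begin
  rank p + len w₂      ≤⟨ +-monoˡ-≤ (len w₂) (rank-≤-len-from-horizontal w₁) ⟩
  len w₁ + len w₂      ≡⟨ eq ⟩
  len w                ≤⟨ shortest (proj₁ fromHome) ⟩
  len (proj₁ fromHome) ≡⟨ len-tightWalk-from-horizontal fromHome ⟩
  rank q               ∎)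
  where
  open ≤-Reasoning
  fromHome : TightWalk (horizontal n) q
  fromHome = ⊑⇒tightWalk (horizontal-⊑ q)

⊑⇒≼ : ∀ {n} {p q : State n} → p ⊑ q → p ≼[ horizontal n ] q
⊑⇒≼ {n} {p} {q} p⊑q = proj₁ viaP , shortest , passesThrough-++ʷ (proj₁ toP) (proj₁ fromP)
  where
  toP : TightWalk (horizontal n) p
  toP = ⊑⇒tightWalk (horizontal-⊑ p)
  fromP : TightWalk p q
  fromP = ⊑⇒tightWalk p⊑q
  viaP : TightWalk (horizontal n) q
  viaP = tight-++ʷ toP fromP
  shortest : Shortest (proj₁ viaP)
  shortest w = subst (_≤ len w) (sym (len-tightWalk-from-horizontal viaP)) (rank-≤-len-from-horizontal w)

-- In joinFrom d p q and meetFrom d p q, d is the amount by which the north count of p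
-- leads that of q so far; when the lead is 0 and the paths part, the arguments are
-- swapped so that the path going north becomes the leader.
joinFrom : ∀ {n} → ℕ → State n → State n → State n
joinFrom d       []      []      = []
joinFrom d       (N ∷ p) (N ∷ q) = N ∷ joinFrom d p q
joinFrom d       (E ∷ p) (E ∷ q) = E ∷ joinFrom d p q
joinFrom zero    (N ∷ p) (E ∷ q) = N ∷ joinFrom 1 p q
joinFrom zero    (E ∷ p) (N ∷ q) = N ∷ joinFrom 1 q p
joinFrom (suc d) (N ∷ p) (E ∷ q) = N ∷ joinFrom (2 + d) p q
joinFrom (suc d) (E ∷ p) (N ∷ q) = E ∷ joinFrom d p q

meetFrom : ∀ {n} → ℕ → State n → State n → State n
meetFrom d       []      []      = []
meetFrom d       (N ∷ p) (N ∷ q) = N ∷ meetFrom d p q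
meetFrom d       (E ∷ p) (E ∷ q) = E ∷ meetFrom d p q
meetFrom zero    (N ∷ p) (E ∷ q) = E ∷ meetFrom 1 p q
meetFrom zero    (E ∷ p) (N ∷ q) = E ∷ meetFrom 1 q p
meetFrom (suc d) (N ∷ p) (E ∷ q) = E ∷ meetFrom (2 + d) p q
meetFrom (suc d) (E ∷ p) (N ∷ q) = N ∷ meetFrom d p q

northCount-joinFrom : ∀ {n} d (p q : State n) j →
                      d + northCount (joinFrom d p q) j ≡ (d + northCount p j) ⊔ northCount q j
northCount-joinFrom d       p       q       zero    = sym (⊔-identityʳ (d + 0))
northCount-joinFrom d       []      []      (suc j) = sym (⊔-identityʳ (d + 0))
northCount-joinFrom d       (N ∷ p) (N ∷ q) (suc j) =
  trans (+-suc d _) (trans (cong suc (northCount-joinFrom d p q j))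
                           (cong (_⊔ suc (northCount q j)) (sym (+-suc d (northCount p j)))))
northCount-joinFrom d       (E ∷ p) (E ∷ q) (suc j) = northCount-joinFrom d p q j
northCount-joinFrom zero    (N ∷ p) (E ∷ q) (suc j) = northCount-joinFrom 1 p q j
northCount-joinFrom zero    (E ∷ p) (N ∷ q) (suc j) =
  trans (northCount-joinFrom 1 q p j) (⊔-comm (suc (northCount q j)) (northCount p j))
northCount-joinFrom (suc d) (N ∷ p) (E ∷ q) (suc j) =
  trans (+-suc (suc d) _) (trans (northCount-joinFrom (2 + d) p q j)
                                 (cong (_⊔ northCount q j) (sym (+-suc (suc d) (northCount p j)))))
northCount-joinFrom (suc d) (E ∷ p) (N ∷ q) (suc j) = cong suc (northCount-joinFrom d p q j)

northCount-meetFrom : ∀ {n} d (p q : State n) j →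
                      northCount (meetFrom d p q) j ≡ (d + northCount p j) ⊓ northCount q j
northCount-meetFrom d       p       q       zero    = sym (⊓-zeroʳ (d + 0))
northCount-meetFrom d       []      []      (suc j) = sym (⊓-zeroʳ (d + 0))
northCount-meetFrom d       (N ∷ p) (N ∷ q) (suc j) =
  trans (cong suc (northCount-meetFrom d p q j))
        (cong (_⊓ suc (northCount q j)) (sym (+-suc d (northCount p j))))
northCount-meetFrom d       (E ∷ p) (E ∷ q) (suc j) = northCount-meetFrom d p q j
northCount-meetFrom zero    (N ∷ p) (E ∷ q) (suc j) = northCount-meetFrom 1 p q j
northCount-meetFrom zero    (E ∷ p) (N ∷ q) (suc j) =
  trans (northCount-meetFrom 1 q p j) (⊓-comm (suc (northCount q j)) (northCount p j))
northCount-meetFrom (suc d) (N ∷ p) (E ∷ q) (suc j) =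
  trans (northCount-meetFrom (2 + d) p q j)
        (cong (_⊓ northCount q j) (sym (+-suc (suc d) (northCount p j))))
northCount-meetFrom (suc d) (E ∷ p) (N ∷ q) (suc j) = cong suc (northCount-meetFrom d p q j)

_∨_ : ∀ {n} → Op₂ (State n)
_∨_ = joinFrom 0

_∧_ : ∀ {n} → Op₂ (State n)
_∧_ = meetFrom 0

northCount-∨ : ∀ {n} (p q : State n) j → northCount (p ∨ q) j ≡ northCount p j ⊔ northCount q j
northCount-∨ = northCount-joinFrom 0

northCount-∧ : ∀ {n} (p q : State n) j → northCount (p ∧ q) j ≡ northCount p j ⊓ northCount q j
northCount-∧ = northCount-meetFrom 0

corollary4p3 : (n : ℕ) → 1 ≤ n →
    Σ (Op₂ (State n)) (λ _∨_ → Σ (Op₂ (State n)) (λ _∧_ →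
      IsDistributiveLattice _≡_ (λ p q → p ≼[ horizontal n ] q) _∨_ _∧_))
corollary4p3 n _ = _∨_ , _∧_ , isDistributiveLattice
  where
  open PointwiseSublattice northCount northCount-injective ≼⇒⊑ ⊑⇒≼
                           _∨_ _∧_ northCount-∨ northCount-∧
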